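{- Let $d \geq 1$ and $k$ be integers with $d < k \leq 4d-4$. Then for all sufficiently large $n$, $f(n,k,d,2) \leq d^2-d+1$. That is, for $n$ sufficiently large there exists a graph $G$ on $n$ vertices with minimum degree at least $k$ and a coloring of its edges with two colors such that every monochromatic subgraph of $G$ with minimum degree at least $d$ has at most $d^2-d+1$ vertices.
   Context: All graphs are finite, simple and undirected. For a graph $G$ and positive integers $d,r$, $f_G(d,r)$ denotes the largest integer $t$ such that in every coloring of the edges of $G$ with $r$ colors there is a monochromatic subgraph (a subgraph all of whose edges have the same color) with minimum degree at least $d$ and order (number of vertices) at least $t$. For $n > k > d$, $f(n,k,d,r)$ denotes the minimum of $f_G(d,r)$ over all graphs $G$ with $n$ vertices and minimum degree at least $k$. -}

module Defs where

open import Data.Nat using (ℕ; _≤_)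
open import Data.Bool using (Bool; true; false; if_then_else_)
open import Data.Fin using (Fin)
open import Data.Fin.Subset using (Subset; inside; outside; ∣_∣; _∈_)
open import Data.Vec using (tabulate)
open import Data.Product using (_×_)
open import Relation.Binary.PropositionalEquality using (_≡_)

record Graph (n : ℕ) : Set where
  field
    adj    : Fin n → Fin n → Bool
    sym    : ∀ u v → adj u v ≡ adj v u
    irrefl : ∀ v → adj v v ≡ false

nbhd : {n : ℕ} → (Fin n → Fin n → Bool) → Fin n → Subset n
nbhd a v = tabulate (λ u → if a v u then inside else outside)

deg : {n : ℕ} → (Fin n → Fin n → Bool) → Fin n → ℕ
deg a v = ∣ nbhd a v ∣

MinDeg≥ : {n : ℕ} → Graph n → ℕ → Set
MinDeg≥ G k = ∀ v → k ≤ deg (Graph.adj G) v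

-- an r-coloring of the edges of G: a symmetric colour assignment to
-- pairs of vertices (only its values on edges of G are relevant)
record Coloring {n : ℕ} (G : Graph n) (r : ℕ) : Set where
  field
    col    : Fin n → Fin n → Fin r
    colSym : ∀ u v → col u v ≡ col v u

record Subgraph {n : ℕ} (G : Graph n) : Set where
  field
    V     : Subset n
    E     : Fin n → Fin n → Bool
    Esym  : ∀ u v → E u v ≡ E v u
    E⊆G   : ∀ u v → E u v ≡ true → Graph.adj G u v ≡ true
    E⊆V   : ∀ u v → E u v ≡ true → (u ∈ V) × (v ∈ V)

order : {n : ℕ} {G : Graph n} → Subgraph G → ℕ
order H = ∣ Subgraph.V H ∣

SubMinDeg≥ : {n : ℕ} {G : Graph n} → Subgraph G → ℕ → Set
SubMinDeg≥ H d = ∀ v → v ∈ Subgraph.V H → d ≤ deg (Subgraph.E H) v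

Monochromatic : {n r : ℕ} {G : Graph n} → Coloring G r → Fin r → Subgraph G → Set
Monochromatic c i H =
  ∀ u v → Subgraph.E H u v ≡ true → Coloring.col c u v ≡ i

module Submission where

-- Take the circulant graph on ℤ/n joining vertices at circular distance at most
-- D = 2(d − 1); it is 2D = (4d − 4)-regular.  Colour its edges so that, in the
-- order 0 < 1 < ⋯ < n − 1, every vertex outside the last m = 3(d − 1) vertices has
-- at most d − 1 red neighbours above it, and every vertex outside the first m has
-- at most d − 1 blue neighbours below it.  The least vertex of a red subgraph of
-- minimum degree d has all its neighbours above it, so it lies among the last m
-- vertices, and hence so does the whole subgraph; dually for blue.  So every
-- monochromatic subgraph of minimum degree d has at most 3(d − 1) ≤ d² − d + 1
-- vertices.

open import Defs
open import Data.Nat using (ℕ; _≤_; _<_; _*_; _∸_; _+_)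
open import Data.Fin using (Fin)
open import Data.Product using (Σ; ∃; _×_)

open import Data.Bool using (Bool; true; false; if_then_else_)
open import Data.Bool.Properties using (¬-not)
open import Data.Fin using (zero; suc; toℕ)
open import Data.Fin.Properties using (toℕ<n; toℕ≤n; toℕ-injective)
open import Data.Fin.Subset using (Subset; inside; outside; ∣_∣; _∈_; _⊆_; _∪_; ∁; ⁅_⁆; ⊥)
open import Data.Fin.Subset.Properties
  using (∣⊥∣≡0; p⊆q⇒∣p∣≤∣q∣; x∈∁p⇒x∉p; ∣∁p∣≡n∸∣p∣; ∣p∣≤n; ∣⁅x⁆∣≡1; x∈⁅x⁆; x∈p∪q⁺)
open import Data.Nat using (zero; suc; z≤n; s≤s; s≤s⁻¹; _⊓_; _⊔_)
open import Data.Nat.Properties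
open import Data.Nat.Induction using (<-wellFounded)
open import Data.Product using (_,_; proj₁; proj₂)
open import Data.Sum using (_⊎_; inj₁; inj₂)
import Data.Sum as Sum
open import Data.Vec using (_∷_; []; _[_]=_)
open _[_]=_ using (here; there)
open import Data.Vec.Properties using (lookup∘tabulate; []=⇒lookup; lookup⇒[]=)
open import Function.Base using (_∘_; _on_)
open import Function.Definitions using (Injective)
open import Induction.WellFounded using (Acc; acc)
open import Relation.Binary.Construct.On using (wellFounded)
open import Relation.Binary.Definitions using (Decidable; tri<; tri≈; tri>)
open import Relation.Nullary using (¬_; Dec; yes; no; does; proof; contradiction)
open import Relation.Nullary.Decidable using (dec-false; _×-dec_; _⊎-dec_)
open import Relation.Nullary.Reflects using (Reflects; invert)
open import Relation.Binary.PropositionalEquality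
open import Data.Nat.Tactic.RingSolver using (solve-∀)

InInterval : ℕ → ℕ → ℕ → Set
InInterval lo len y = lo ≤ y × y < lo + len

interval : ∀ {n} → ℕ → ℕ → Subset n
interval {zero}  _        _         = []
interval {suc n} zero     zero      = ⊥
interval {suc n} zero     (suc len) = inside ∷ interval zero len
interval {suc n} (suc lo) len       = outside ∷ interval lo len

∣interval∣≤ : ∀ {n} lo len → ∣ interval {n} lo len ∣ ≤ len
∣interval∣≤ {zero}  _        _         = z≤n
∣interval∣≤ {suc n} zero     zero      = ≤-reflexive (∣⊥∣≡0 (suc n))
∣interval∣≤ {suc n} zero     (suc len) = s≤s (∣interval∣≤ {n} zero len)
∣interval∣≤ {suc n} (suc lo) len       = ∣interval∣≤ {n} lo len

∈-interval : ∀ {n lo len} (u : Fin n) → InInterval lo len (toℕ u) → u ∈ interval lo len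
∈-interval {lo = zero}   {suc len} zero    _                       = here
∈-interval {lo = zero}   {suc len} (suc u) (_ , s≤s u<len)         = there (∈-interval u (z≤n , u<len))
∈-interval {lo = suc lo}           (suc u) (s≤s lo≤u , s≤s u<lo+len) = there (∈-interval u (lo≤u , u<lo+len))

∣p∪q∣≤∣p∣+∣q∣ : ∀ {n} (p q : Subset n) → ∣ p ∪ q ∣ ≤ ∣ p ∣ + ∣ q ∣
∣p∪q∣≤∣p∣+∣q∣ []            []            = z≤n
∣p∪q∣≤∣p∣+∣q∣ (outside ∷ p) (outside ∷ q) = ∣p∪q∣≤∣p∣+∣q∣ p q
∣p∪q∣≤∣p∣+∣q∣ (outside ∷ p) (inside  ∷ q) =
  subst (suc ∣ p ∪ q ∣ ≤_) (sym (+-suc ∣ p ∣ ∣ q ∣)) (s≤s (∣p∪q∣≤∣p∣+∣q∣ p q))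
∣p∪q∣≤∣p∣+∣q∣ (inside  ∷ p) (outside ∷ q) = s≤s (∣p∪q∣≤∣p∣+∣q∣ p q)
∣p∪q∣≤∣p∣+∣q∣ (inside  ∷ p) (inside  ∷ q) =
  s≤s (≤-trans (∣p∪q∣≤∣p∣+∣q∣ p q) (+-monoʳ-≤ ∣ p ∣ (n≤1+n ∣ q ∣)))

n∸∣∁p∣≤∣p∣ : ∀ {n} (p : Subset n) {k} → ∣ ∁ p ∣ ≤ k → n ∸ k ≤ ∣ p ∣
n∸∣∁p∣≤∣p∣ {n} p {k} ∣∁p∣≤k = begin
  n ∸ k             ≤⟨ ∸-monoʳ-≤ n ∣∁p∣≤k ⟩
  n ∸ ∣ ∁ p ∣       ≡⟨ cong (n ∸_) (∣∁p∣≡n∸∣p∣ p) ⟩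
  n ∸ (n ∸ ∣ p ∣)   ≡⟨ m∸[m∸n]≡n (∣p∣≤n p) ⟩
  ∣ p ∣             ∎
  where open ≤-Reasoning

module _ {n : ℕ} (a : Fin n → Fin n → Bool) (v : Fin n) where

  ∈-nbhd⁻ : ∀ {u} → u ∈ nbhd a v → a v u ≡ true
  ∈-nbhd⁻ {u} u∈ with a v u | trans (sym (lookup∘tabulate _ u)) ([]=⇒lookup u∈)
  ... | true  | _  = refl
  ... | false | ()

  ∈-nbhd⁺ : ∀ {u} → a v u ≡ true → u ∈ nbhd a v
  ∈-nbhd⁺ {u} avu = lookup⇒[]= u _ (trans (lookup∘tabulate _ u) (cong (if_then inside else outside) avu))

  ∈∁nbhd⇒non-adjacent : ∀ {u} → u ∈ ∁ (nbhd a v) → a v u ≡ false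
  ∈∁nbhd⇒non-adjacent u∈ = ¬-not (x∈∁p⇒x∉p u∈ ∘ ∈-nbhd⁺)

ForwardSparse : ∀ {n r} {G : Graph n} → Coloring G r → Fin r → (Fin n → ℕ) → ℕ → ℕ → Set
ForwardSparse {n} {G = G} c i ρ t d =
  ∀ x → ρ x < t → Σ (Subset n) λ F → ∣ F ∣ < d ×
    (∀ u → ρ x < ρ u → Graph.adj G x u ≡ true → Coloring.col c x u ≡ i → u ∈ F)

forwardSparse⇒rank≥ : ∀ {n r} {G : Graph n} {c : Coloring G r} {i : Fin r} {ρ : Fin n → ℕ} {t d : ℕ} →
  ForwardSparse c i ρ t d → Injective _≡_ _≡_ ρ →
  (H : Subgraph G) → Monochromatic c i H → SubMinDeg≥ H d →
  ∀ x → x ∈ Subgraph.V H → t ≤ ρ x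
forwardSparse⇒rank≥ {G = G} {ρ = ρ} {t} {d} sparse ρ-injective H mono minDeg x =
  excluded x (wellFounded ρ <-wellFounded x)
  where
  open Subgraph H

  excluded : ∀ x → Acc (_<_ on ρ) x → x ∈ V → t ≤ ρ x
  excluded x (acc below) x∈V with t ≤? ρ x
  ... | yes t≤ρx = t≤ρx
  ... | no  t≰ρx = contradiction (≤-trans (minDeg x x∈V) (p⊆q⇒∣p∣≤∣q∣ nbhd⊆F)) (<⇒≱ ∣F∣<d)
    where
    ρx<t = ≰⇒> t≰ρx
    F = proj₁ (sparse x ρx<t)
    ∣F∣<d = proj₁ (proj₂ (sparse x ρx<t))
    nbhd⊆F : nbhd E x ⊆ F
    nbhd⊆F {u} u∈ with ∈-nbhd⁻ E x u∈ | <-cmp (ρ u) (ρ x)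
    ... | Exu | tri< ρu<ρx _ _ =
      contradiction (excluded u (below ρu<ρx) (proj₂ (E⊆V x u Exu))) (<⇒≱ (<-trans ρu<ρx ρx<t))
    ... | Exu | tri≈ _ ρu≡ρx _ with refl ← ρ-injective ρu≡ρx =
      contradiction (trans (sym (E⊆G u u Exu)) (Graph.irrefl G u)) λ ()
    ... | Exu | tri> _ _ ρx<ρu = proj₂ (proj₂ (sparse x ρx<t)) u ρx<ρu (E⊆G x u Exu) (mono x u Exu)

unordered : {A : Set} → (ℕ → ℕ → A) → ℕ → ℕ → A
unordered f x y = f (x ⊓ y) (x ⊔ y)

unordered-comm : ∀ {A : Set} (f : ℕ → ℕ → A) x y → unordered f x y ≡ unordered f y x
unordered-comm f x y = cong₂ f (⊓-comm x y) (⊔-comm x y)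

unordered-≤ : ∀ {A : Set} (f : ℕ → ℕ → A) {x y} → x ≤ y → unordered f x y ≡ f x y
unordered-≤ f x≤y = cong₂ f (m≤n⇒m⊓n≡m x≤y) (m≤n⇒m⊔n≡n x≤y)

red blue : Fin 2
red  = zero
blue = suc zero

colourOf : {A : Set} → Dec A → Fin 2
colourOf (yes _) = red
colourOf (no _)  = blue

module PairGraph {R C : ℕ → ℕ → Set} (R? : Decidable R) (R-irrefl : ∀ a → ¬ R a a)
                 (C? : Decidable C) (n : ℕ) where

  sortedAdj : ℕ → ℕ → Bool
  sortedAdj a b = does (R? a b)

  sortedCol : ℕ → ℕ → Fin 2
  sortedCol a b = colourOf (C? a b)

  graph : Graph n
  graph = record
    { adj    = λ u v → unordered sortedAdj (toℕ u) (toℕ v)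
    ; sym    = λ u v → unordered-comm sortedAdj (toℕ u) (toℕ v)
    ; irrefl = λ v → trans (unordered-≤ sortedAdj ≤-refl) (dec-false (R? _ _) (R-irrefl _))
    }

  colouring : Coloring graph 2
  colouring = record
    { col    = λ u v → unordered sortedCol (toℕ u) (toℕ v)
    ; colSym = λ u v → unordered-comm sortedCol (toℕ u) (toℕ v)
    }

  open Graph graph using (adj)
  open Coloring colouring using (col)

  adjacent⇒R : ∀ {u v} → toℕ u ≤ toℕ v → adj u v ≡ true → R (toℕ u) (toℕ v)
  adjacent⇒R {u} {v} u≤v eq =
    invert (subst (Reflects _) (trans (sym (unordered-≤ sortedAdj u≤v)) eq) (proof (R? (toℕ u) (toℕ v))))

  non-adjacent⇒¬R : ∀ {u v} → toℕ u ≤ toℕ v → adj u v ≡ false → ¬ R (toℕ u) (toℕ v)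
  non-adjacent⇒¬R {u} {v} u≤v eq =
    invert (subst (Reflects _) (trans (sym (unordered-≤ sortedAdj u≤v)) eq) (proof (R? (toℕ u) (toℕ v))))

  red⇒C : ∀ {u v} → toℕ u ≤ toℕ v → col u v ≡ red → C (toℕ u) (toℕ v)
  red⇒C {u} {v} u≤v eq with C? (toℕ u) (toℕ v) | unordered-≤ sortedCol u≤v
  ... | yes c | _ = c
  ... | no  _ | e = contradiction (trans (sym e) eq) λ ()

  blue⇒¬C : ∀ {u v} → toℕ u ≤ toℕ v → col u v ≡ blue → ¬ C (toℕ u) (toℕ v)
  blue⇒¬C {u} {v} u≤v eq with C? (toℕ u) (toℕ v) | unordered-≤ sortedCol u≤v
  ... | yes _ | e = contradiction (trans (sym e) eq) λ ()
  ... | no ¬c | _ = ¬c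

module Construction (s n : ℕ) (D+D<n : (s + s) + (s + s) < n) where

  D m L : ℕ
  D = s + s
  m = s + D
  L = n ∸ suc (D + D)

  n≡2D+1+L : n ≡ suc (D + D) + L
  n≡2D+1+L = sym (m+[n∸m]≡n D+D<n)

  -- for a < b in [0, n): a and b are at circular distance at most D, directly or around the end
  Near : ℕ → ℕ → Set
  Near a b = a < b × (b ≤ a + D ⊎ a + n ≤ b + D)

  -- red edges {a < b}: edges of length at most s not starting among the first D vertices,
  -- edges starting among the last m vertices, and wrap-around edges of circular length above s
  Red : ℕ → ℕ → Set
  Red a b = (D ≤ a × b ≤ a + s) ⊎ n ≤ a + m ⊎ (a + D < b × b + s < a + n)

  near? : Decidable Near
  near? a b = a <? b ×-dec (b ≤? a + D ⊎-dec a + n ≤? b + D)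

  red? : Decidable Red
  red? a b = (D ≤? a ×-dec b ≤? a + s) ⊎-dec n ≤? a + m ⊎-dec (a + D <? b ×-dec b + s <? a + n)

  near-irrefl : ∀ a → ¬ Near a a
  near-irrefl a (a<a , _) = <-irrefl refl a<a

  open PairGraph near? near-irrefl red? n public

  Far : ℕ → ℕ → Set
  Far a b = a + D < b × b + D < a + n

  ¬near⇒far : ∀ {a b} → a < b → ¬ Near a b → Far a b
  ¬near⇒far a<b ¬near = ≰⇒> (¬near ∘ (a<b ,_) ∘ inj₁) , ≰⇒> (¬near ∘ (a<b ,_) ∘ inj₂)

  non-adjacent⇒far : ∀ {v y} → Graph.adj graph v y ≡ false →
                     y ≡ v ⊎ Far (toℕ v) (toℕ y) ⊎ Far (toℕ y) (toℕ v)
  non-adjacent⇒far {v} {y} v≁y with <-cmp (toℕ v) (toℕ y)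
  ... | tri< v<y _ _ = inj₂ (inj₁ (¬near⇒far v<y (non-adjacent⇒¬R (<⇒≤ v<y) v≁y)))
  ... | tri≈ _ v≡y _ = inj₁ (toℕ-injective (sym v≡y))
  ... | tri> _ _ y<v =
    inj₂ (inj₂ (¬near⇒far y<v (non-adjacent⇒¬R (<⇒≤ y<v) (trans (Graph.sym graph y v) v≁y))))

  -- The vertices far from t form an arc of length L of ℤ/n, which is cut by 0 into at most two intervals.
  record FarCover (t : ℕ) : Set where
    field
      lo₁ len₁ lo₂ len₂ : ℕ
      total  : len₁ + len₂ ≡ L
      covers : ∀ {y} → y < n → Far t y ⊎ Far y t → InInterval lo₁ len₁ y ⊎ InInterval lo₂ len₂ y

  farCover-low : ∀ {t} → t < D → FarCover t
  farCover-low {t} t<D = record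
    { lo₁ = suc (t + D) ; len₁ = L ; lo₂ = 0 ; len₂ = 0 ; total = +-identityʳ L ; covers = covers }
    where
    covers : ∀ {y} → y < n → Far t y ⊎ Far y t → InInterval (suc (t + D)) L y ⊎ InInterval 0 0 y
    covers {y} _ (inj₁ (t+D<y , y+D<t+n)) =
      inj₁ (t+D<y , +-cancelʳ-< D y (suc (t + D) + L)
                      (subst (y + D <_) (trans (cong (t +_) n≡2D+1+L) (identity t D L)) y+D<t+n))
      where
      identity : ∀ t x l → t + (suc (x + x) + l) ≡ suc (t + x) + l + x
      identity = solve-∀
    covers {y} _ (inj₂ (y+D<t , _)) = contradiction (<-trans y+D<t t<D) (≤⇒≯ (m≤n+m D y))

  farCover-middle : ∀ {t} → D ≤ t → t + D < n → FarCover t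
  farCover-middle {t} D≤t t+D<n = record
    { lo₁ = suc (t + D) ; len₁ = b ; lo₂ = 0 ; len₂ = a ; total = b+a≡L ; covers = covers }
    where
    a = proj₁ (m≤n⇒∃[o]m+o≡n D≤t)
    b = proj₁ (m≤n⇒∃[o]m+o≡n t+D<n)
    D+a≡t : D + a ≡ t
    D+a≡t = proj₂ (m≤n⇒∃[o]m+o≡n D≤t)
    t+D+b≡n : suc (t + D) + b ≡ n
    t+D+b≡n = proj₂ (m≤n⇒∃[o]m+o≡n t+D<n)
    b+a≡L : b + a ≡ L
    b+a≡L = +-cancelˡ-≡ (suc (D + D)) (b + a) L (begin
      suc (D + D) + (b + a) ≡⟨ identity D a b ⟩
      suc (D + a + D) + b   ≡⟨ cong (λ t → suc (t + D) + b) D+a≡t ⟩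
      suc (t + D) + b       ≡⟨ t+D+b≡n ⟩
      n                     ≡⟨ n≡2D+1+L ⟩
      suc (D + D) + L       ∎)
      where
      open ≡-Reasoning
      identity : ∀ x a b → suc (x + x) + (b + a) ≡ suc (x + a + x) + b
      identity = solve-∀
    covers : ∀ {y} → y < n → Far t y ⊎ Far y t → InInterval (suc (t + D)) b y ⊎ InInterval 0 a y
    covers {y} y<n (inj₁ (t+D<y , _)) = inj₁ (t+D<y , subst (y <_) (sym t+D+b≡n) y<n)
    covers {y} _ (inj₂ (y+D<t , _)) =
      inj₂ (z≤n , +-cancelʳ-< D y a (subst (y + D <_) (trans (sym D+a≡t) (+-comm D a)) y+D<t))

  farCover-high : ∀ {t} → n ≤ t + D → FarCover t
  farCover-high {t} n≤t+D = record
    { lo₁ = suc c ; len₁ = L ; lo₂ = 0 ; len₂ = 0 ; total = +-identityʳ L ; covers = covers }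
    where
    c = proj₁ (m≤n⇒∃[o]m+o≡n n≤t+D)
    n+c≡t+D : n + c ≡ t + D
    n+c≡t+D = proj₂ (m≤n⇒∃[o]m+o≡n n≤t+D)
    t≡c+L+D : t ≡ suc c + L + D
    t≡c+L+D = +-cancelʳ-≡ D t (suc c + L + D) (begin
      t + D                 ≡⟨ n+c≡t+D ⟨
      n + c                 ≡⟨ cong (_+ c) n≡2D+1+L ⟩
      suc (D + D) + L + c   ≡⟨ identity D L c ⟩
      suc c + L + D + D     ∎)
      where
      open ≡-Reasoning
      identity : ∀ x l c → suc (x + x) + l + c ≡ suc c + l + x + x
      identity = solve-∀
    covers : ∀ {y} → y < n → Far t y ⊎ Far y t → InInterval (suc c) L y ⊎ InInterval 0 0 y
    covers y<n (inj₁ (t+D<y , _)) = contradiction (≤-trans n≤t+D (<⇒≤ t+D<y)) (<⇒≱ y<n)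
    covers {y} _ (inj₂ (y+D<t , t+D<y+n)) = inj₁
      ( +-cancelʳ-< n c y (subst (_< y + n) (sym (trans (+-comm c n) n+c≡t+D)) t+D<y+n)
      , +-cancelʳ-< D y (suc c + L) (subst (y + D <_) t≡c+L+D y+D<t))

  farCover : ∀ {t} → FarCover t
  farCover {t} with t <? D | t + D <? n
  ... | yes t<D | _         = farCover-low t<D
  ... | no  t≮D | yes t+D<n = farCover-middle (≮⇒≥ t≮D) t+D<n
  ... | no  _   | no  t+D≮n = farCover-high (≮⇒≥ t+D≮n)

  minDegree : MinDeg≥ graph (D + D)
  minDegree v = subst (_≤ deg adj v) n∸[1+L]≡D+D (n∸∣∁p∣≤∣p∣ (nbhd adj v) ∣non-neighbours∣≤)
    where
    open Graph graph using (adj)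
    open FarCover (farCover {toℕ v})

    n∸[1+L]≡D+D : n ∸ suc L ≡ D + D
    n∸[1+L]≡D+D = trans (cong (_∸ suc L) n≡2D+1+L) (m+n∸n≡m (D + D) L)

    I₁ I₂ : Subset n
    I₁ = interval lo₁ len₁
    I₂ = interval lo₂ len₂

    non-neighbours⊆ : ∁ (nbhd adj v) ⊆ ⁅ v ⁆ ∪ (I₁ ∪ I₂)
    non-neighbours⊆ {y} y∈ with non-adjacent⇒far {v} {y} (∈∁nbhd⇒non-adjacent adj v y∈)
    ... | inj₁ refl = x∈p∪q⁺ (inj₁ (x∈⁅x⁆ v))
    ... | inj₂ far  =
      x∈p∪q⁺ (inj₂ (x∈p∪q⁺ (Sum.map (∈-interval y) (∈-interval y) (covers (toℕ<n y) far))))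

    ∣non-neighbours∣≤ : ∣ ∁ (nbhd adj v) ∣ ≤ suc L
    ∣non-neighbours∣≤ = begin
      ∣ ∁ (nbhd adj v) ∣       ≤⟨ p⊆q⇒∣p∣≤∣q∣ non-neighbours⊆ ⟩
      ∣ ⁅ v ⁆ ∪ (I₁ ∪ I₂) ∣    ≤⟨ ∣p∪q∣≤∣p∣+∣q∣ ⁅ v ⁆ (I₁ ∪ I₂) ⟩
      ∣ ⁅ v ⁆ ∣ + ∣ I₁ ∪ I₂ ∣  ≤⟨ +-mono-≤ (≤-reflexive (∣⁅x⁆∣≡1 v)) (∣p∪q∣≤∣p∣+∣q∣ I₁ I₂) ⟩
      1 + (∣ I₁ ∣ + ∣ I₂ ∣)    ≤⟨ s≤s (+-mono-≤ (∣interval∣≤ {n} lo₁ len₁) (∣interval∣≤ {n} lo₂ len₂)) ⟩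
      suc (len₁ + len₂)        ≡⟨ cong suc total ⟩
      suc L                    ∎
      where open ≤-Reasoning

  m≤n : m ≤ n
  m≤n = ≤-trans (+-monoˡ-≤ D (m≤m+n s s)) (<⇒≤ D+D<n)

  wrap⇒far : ∀ {a b} → a + n ≤ b + D → a + D < b
  wrap⇒far {a} {b} a+n≤b+D = +-cancelʳ-< D (a + D) b (begin-strict
    a + D + D   ≡⟨ +-assoc a D D ⟩
    a + (D + D) <⟨ +-monoʳ-< a D+D<n ⟩
    a + n       ≤⟨ a+n≤b+D ⟩
    b + D       ∎)
    where open ≤-Reasoning

  w : ℕ
  w = suc (D + L)

  +n≡+w+D : ∀ a → a + n ≡ a + w + D
  +n≡+w+D a = trans (cong (a +_) n≡2D+1+L) (identity a D L)
    where
    identity : ∀ a x y → a + (suc (x + x) + y) ≡ a + suc (x + y) + x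
    identity = solve-∀

  red-above-far : ∀ {a b} → D ≤ a → b < n → a + m < n → Near a b → Red a b → InInterval (suc a) s b
  red-above-far _ _ _ (a<b , _) (inj₁ (_ , b≤a+s)) = a<b , s≤s b≤a+s
  red-above-far _ _ a+m<n _ (inj₂ (inj₁ n≤a+m)) = contradiction n≤a+m (<⇒≱ a+m<n)
  red-above-far _ _ _ (_ , inj₁ b≤a+D) (inj₂ (inj₂ (a+D<b , _))) = contradiction b≤a+D (<⇒≱ a+D<b)
  red-above-far {a} {b} D≤a b<n _ (_ , inj₂ a+n≤b+D) (inj₂ (inj₂ _)) =
    contradiction a+n≤b+D (<⇒≱ (subst (b + D <_) (+-comm n a) (+-mono-<-≤ b<n D≤a)))

  red-above-near : ∀ {a b} → a < D → a + m < n → Near a b → Red a b → InInterval (a + w) s b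
  red-above-near a<D _ _ (inj₁ (D≤a , _)) = contradiction D≤a (<⇒≱ a<D)
  red-above-near _ a+m<n _ (inj₂ (inj₁ n≤a+m)) = contradiction n≤a+m (<⇒≱ a+m<n)
  red-above-near _ _ (_ , inj₁ b≤a+D) (inj₂ (inj₂ (a+D<b , _))) = contradiction b≤a+D (<⇒≱ a+D<b)
  red-above-near {a} {b} _ _ (_ , inj₂ a+n≤b+D) (inj₂ (inj₂ (_ , b+s<a+n))) =
    +-cancelʳ-≤ D (a + w) b (subst (_≤ b + D) (+n≡+w+D a) a+n≤b+D) ,
    +-cancelʳ-< s b (a + w + s) (subst (b + s <_) (trans (+n≡+w+D a) (sym (+-assoc (a + w) s s))) b+s<a+n)

  redWindow : ℕ → ℕ
  redWindow a with D ≤? a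
  ... | yes _ = suc a
  ... | no  _ = a + w

  red-above : ∀ {a b} → b < n → a + m < n → Near a b → Red a b → InInterval (redWindow a) s b
  red-above {a} b<n with D ≤? a
  ... | yes D≤a = red-above-far D≤a b<n
  ... | no  D≰a = red-above-near (≰⇒> D≰a)

  blue-below-inner : ∀ {a b} → m ≤ b → b + s < n → Near a b → ¬ Red a b → InInterval (b ∸ D) s a
  blue-below-inner {a} {b} _ b+s<n (_ , inj₂ a+n≤b+D) ¬red =
    contradiction (inj₂ (inj₂ (wrap⇒far a+n≤b+D , <-≤-trans b+s<n (m≤n+m n a)))) ¬red
  blue-below-inner {a} {b} m≤b _ (_ , inj₁ b≤a+D) ¬red =
    m≤n+o⇒m∸n≤o b D (subst (b ≤_) (+-comm a D) b≤a+D) ,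
    +-cancelʳ-< s a (b ∸ D + s) (subst (a + s <_) b≡b∸D+s+s a+s<b)
    where
    a+s<b : a + s < b
    a+s<b = ≰⇒> λ b≤a+s →
      ¬red (inj₁ (+-cancelˡ-≤ s D a (subst (m ≤_) (+-comm a s) (≤-trans m≤b b≤a+s)) , b≤a+s))
    b≡b∸D+s+s : b ≡ b ∸ D + s + s
    b≡b∸D+s+s = sym (trans (+-assoc (b ∸ D) s s) (m∸n+n≡m (≤-trans (m≤n+m D s) m≤b)))

  blue-below-end : ∀ {a b} → b < n → n ≤ b + s → Near a b → ¬ Red a b → InInterval 0 s a
  blue-below-end {a} {b} _ n≤b+s (_ , inj₁ b≤a+D) ¬red =
    contradiction (inj₂ (inj₁ (≤-trans n≤b+s (subst (b + s ≤_) a+D+s≡a+m (+-monoˡ-≤ s b≤a+D))))) ¬red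
    where
    a+D+s≡a+m : a + D + s ≡ a + m
    a+D+s≡a+m = trans (+-assoc a D s) (cong (a +_) (+-comm D s))
  blue-below-end {a} {b} b<n _ (_ , inj₂ a+n≤b+D) ¬red =
    z≤n , ≰⇒> λ s≤a →
      ¬red (inj₂ (inj₂ (wrap⇒far a+n≤b+D , subst (b + s <_) (+-comm n a) (+-mono-<-≤ b<n s≤a))))

  blueWindow : ℕ → ℕ
  blueWindow b with b + s <? n
  ... | yes _ = b ∸ D
  ... | no  _ = 0

  blue-below : ∀ {a b} → m ≤ b → b < n → Near a b → ¬ Red a b → InInterval (blueWindow b) s a
  blue-below {b = b} m≤b b<n with b + s <? n
  ... | yes b+s<n = blue-below-inner m≤b b+s<n
  ... | no  b+s≮n = blue-below-end b<n (≮⇒≥ b+s≮n)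

  red-sparse : ForwardSparse colouring red toℕ (n ∸ m) (suc s)
  red-sparse x x<n∸m =
    interval (redWindow (toℕ x)) s , s≤s (∣interval∣≤ {n} (redWindow (toℕ x)) s) ,
    λ u x<u x~u xu-red →
      ∈-interval u (red-above (toℕ<n u) x+m<n (adjacent⇒R (<⇒≤ x<u) x~u) (red⇒C (<⇒≤ x<u) xu-red))
    where
    x+m<n : toℕ x + m < n
    x+m<n = subst (toℕ x + m <_) (m∸n+n≡m m≤n) (+-monoˡ-< m x<n∸m)

  blue-sparse : ForwardSparse colouring blue (λ x → n ∸ toℕ x) (suc (n ∸ m)) (suc s)
  blue-sparse x n∸x≤n∸m =
    interval (blueWindow (toℕ x)) s , s≤s (∣interval∣≤ {n} (blueWindow (toℕ x)) s) ,
    λ u n∸x<n∸u x~u xu-blue →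
      let u<x = ∸-cancelʳ-< n∸x<n∸u in
      ∈-interval u (blue-below m≤x (toℕ<n x)
        (adjacent⇒R (<⇒≤ u<x) (trans (Graph.sym graph u x) x~u))
        (blue⇒¬C (<⇒≤ u<x) (trans (Coloring.colSym colouring u x) xu-blue)))
    where
    m≤x : m ≤ toℕ x
    m≤x = ∸-cancelʳ-≤ m≤n (s≤s⁻¹ n∸x≤n∸m)

  red-order : (H : Subgraph graph) → Monochromatic colouring red H → SubMinDeg≥ H (suc s) → order H ≤ m
  red-order H mono minDeg = ≤-trans (p⊆q⇒∣p∣≤∣q∣ V⊆last) (∣interval∣≤ {n} (n ∸ m) m)
    where
    V⊆last : Subgraph.V H ⊆ interval (n ∸ m) m
    V⊆last {x} x∈V = ∈-interval x
      ( forwardSparse⇒rank≥ {c = colouring} red-sparse toℕ-injective H mono minDeg x x∈V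
      , subst (toℕ x <_) (sym (m∸n+n≡m m≤n)) (toℕ<n x))

  blue-order : (H : Subgraph graph) → Monochromatic colouring blue H → SubMinDeg≥ H (suc s) → order H ≤ m
  blue-order H mono minDeg = ≤-trans (p⊆q⇒∣p∣≤∣q∣ V⊆first) (∣interval∣≤ {n} 0 m)
    where
    n∸-injective : Injective _≡_ _≡_ (λ (x : Fin n) → n ∸ toℕ x)
    n∸-injective {u} {v} eq = toℕ-injective (∸-cancelˡ-≡ (toℕ≤n u) (toℕ≤n v) eq)
    V⊆first : Subgraph.V H ⊆ interval 0 m
    V⊆first {x} x∈V = ∈-interval x
      (z≤n , ∸-cancelʳ-< {m} {toℕ x} {n}
               (forwardSparse⇒rank≥ {c = colouring} blue-sparse n∸-injective H mono minDeg x x∈V))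

3[d∸1]≤d²∸d+1 : ∀ s → s + (s + s) ≤ suc s * suc s ∸ suc s + 1
3[d∸1]≤d²∸d+1 s = subst (s + (s + s) ≤_) (cong (_+ 1) (sym (m+n∸m≡n (suc s) (s * suc s)))) (bound s)
  where
  bound : ∀ s → s + (s + s) ≤ s * suc s + 1
  bound zero    = z≤n
  bound (suc e) = subst (suc e + (suc e + suc e) ≤_) (identity e) (m≤n+m _ (e * e))
    where
    identity : ∀ e → e * e + (suc e + (suc e + suc e)) ≡ suc e * suc (suc e) + 1
    identity = solve-∀

4d∸4≡4[d∸1] : ∀ s → 4 * suc s ∸ 4 ≡ (s + s) + (s + s)
4d∸4≡4[d∸1] s = trans (cong (_∸ 4) (identity s)) (m+n∸m≡n 4 ((s + s) + (s + s)))
  where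
  identity : ∀ s → 4 * suc s ≡ 4 + ((s + s) + (s + s))
  identity = solve-∀

theorem1 : (d k : ℕ) → 1 ≤ d → d < k → k ≤ 4 * d ∸ 4 →
    ∃ λ (N : ℕ) → ∀ (n : ℕ) → N ≤ n →
      Σ (Graph n) λ G → MinDeg≥ G k ×
        Σ (Coloring G 2) λ c →
          ∀ (i : Fin 2) (H : Subgraph G) →
            Monochromatic c i H → SubMinDeg≥ H d →
            order H ≤ d * d ∸ d + 1
theorem1 zero    _ () _ _
theorem1 (suc s) k _  _ k≤4d∸4 = suc ((s + s) + (s + s)) , λ n 4s<n →
  let open Construction s n 4s<n in
  graph , (λ v → ≤-trans k≤4s (minDegree v)) , colouring , λ where
    zero       H mono minDeg → ≤-trans (red-order H mono minDeg) (3[d∸1]≤d²∸d+1 s)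
    (suc zero) H mono minDeg → ≤-trans (blue-order H mono minDeg) (3[d∸1]≤d²∸d+1 s)
  where
  k≤4s : k ≤ (s + s) + (s + s)
  k≤4s = subst (k ≤_) (4d∸4≡4[d∸1] s) k≤4d∸4
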